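{- Let $k\in\mathbb{N}$ and let $B$ be the $3k\times 2k$ matrix $B=\begin{bmatrix}2\mathbf{I}_{2k}\\ -2\,\mathbf{I}_k\otimes[1,1]\end{bmatrix}$. For any $3k\times 2k$ real matrices $A_1,A_2$ such that (1) $A_1,A_2\ge0$ entrywise; (2) for all $i\in[3k]$ and $j\in[k]$, $A_2(i,2j-1)=A_2(i,2j)$; (3) every row of $A_1+A_2/2$ sums to at most $1$, the matrix $B+A_1-A_2$ has rank $2k$.
   Context: $\mathbf{I}_m$ is the $m\times m$ identity matrix and $\otimes$ the Kronecker product, so $\mathbf{I}_k\otimes[1,1]$ is the $k\times 2k$ matrix whose $j$-th row has ones in columns $2j-1,2j$ and zeros elsewhere. -}

module Defs where

open import Level using (Level; _⊔_; suc)
import Data.Nat as ℕ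
open ℕ using (ℕ)
open import Data.Nat.DivMod using (_/_)
open import Data.Fin as Fin using (Fin; toℕ; splitAt)
open import Data.Sum using (inj₁; inj₂)
open import Data.Product using (Σ; ∃; _×_; _,_)
open import Relation.Nullary using (¬_; yes; no)
open import Relation.Binary.PropositionalEquality using (_≡_)
open import Relation.Binary.Structures using (IsTotalOrder)
open import Function.Definitions using (Injective)
open import Algebra.Bundles using (CommutativeRing)

-- The real numbers, axiomatised as a Dedekind-complete ordered field
-- (this characterises ℝ up to isomorphism).
record RealField (c ℓ₁ ℓ₂ : Level) : Set (Level.suc (c ⊔ ℓ₁ ⊔ ℓ₂)) where
  field
    commutativeRing : CommutativeRing c ℓ₁
  open CommutativeRing commutativeRing public
  field
    _≤_          : Carrier → Carrier → Set ℓ₂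
    isTotalOrder : IsTotalOrder _≈_ _≤_
    +-mono-≤     : ∀ {x y} z → x ≤ y → (x + z) ≤ (y + z)
    *-nonneg     : ∀ {x y} → 0# ≤ x → 0# ≤ y → 0# ≤ (x * y)
    0≉1          : ¬ (0# ≈ 1#)
    _⁻¹          : Carrier → Carrier
    ⁻¹-inverse   : ∀ x → ¬ (x ≈ 0#) → (x * (x ⁻¹)) ≈ 1#
    sup          : (P : Carrier → Set (c ⊔ ℓ₁ ⊔ ℓ₂)) → ∃ P →
                   ∃ (λ b → ∀ x → P x → x ≤ b) →
                   ∃ (λ s → (∀ x → P x → x ≤ s) ×
                            (∀ b → (∀ x → P x → x ≤ b) → s ≤ b))

module _ {c ℓ₁ ℓ₂ : Level} (F : RealField c ℓ₁ ℓ₂) where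
  open RealField F using (Carrier; _≈_; _+_; _*_; -_; _-_; 0#; 1#; _⁻¹)

  Matrix : ℕ → ℕ → Set c
  Matrix m n = Fin m → Fin n → Carrier

  two : Carrier
  two = 1# + 1#

  half : Carrier
  half = two ⁻¹

  sumF : (n : ℕ) → (Fin n → Carrier) → Carrier
  sumF ℕ.zero    f = 0#
  sumF (ℕ.suc n) f = f Fin.zero + sumF n (λ j → f (Fin.suc j))

  _⊞_ : ∀ {m n} → Matrix m n → Matrix m n → Matrix m n
  (M ⊞ N) i j = M i j + N i j

  _⊟_ : ∀ {m n} → Matrix m n → Matrix m n → Matrix m n
  (M ⊟ N) i j = M i j - N i j

  LinIndepCols : ∀ {m n r} → Matrix m n → (Fin r → Fin n) → Set (c ⊔ ℓ₁)
  LinIndepCols {m} {n} {r} M σ =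
    (a : Fin r → Carrier) →
    (∀ i → sumF r (λ j → a j * M i (σ j)) ≈ 0#) →
    ∀ j → a j ≈ 0#

  HasRank : ∀ {m n} → Matrix m n → ℕ → Set (c ⊔ ℓ₁)
  HasRank {m} {n} M r =
    (Σ (Fin r → Fin n) λ σ → Injective _≡_ _≡_ σ × LinIndepCols M σ) ×
    ((σ : Fin (ℕ.suc r) → Fin n) → Injective _≡_ _≡_ σ → ¬ LinIndepCols M σ)

  -- B = [ 2 I_{2k} ; -2 (I_k ⊗ [1,1]) ], rows indexed by Fin (2k + k) (= 3k).
  -- 0-indexed column c lies in pair j iff ⌊c/2⌋ = j.
  Bmat : (k : ℕ) → Matrix (2 ℕ.* k ℕ.+ k) (2 ℕ.* k)
  Bmat k i col with splitAt (2 ℕ.* k) i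
  ... | inj₁ r with r Fin.≟ col
  ...   | yes _ = two
  ...   | no  _ = 0#
  Bmat k i col | inj₂ j with toℕ col / 2 ℕ.≟ toℕ j
  ...   | yes _ = - two
  ...   | no  _ = 0#

-- Let a be a vector with (B + A₁ − A₂) a = 0, and let N be the largest of the |a_c|.
-- Row i of the kernel equation reads (B a)_i = (A₂ a)_i − (A₁ a)_i, and the right-hand
-- side is at most N times the row sums of A₁ and A₂ (with A₂ counted twice), hence at
-- most 2N by the row-sum condition.  On the lower rows, (B a)_i = −2 (a_{2j−1} + a_{2j}),
-- so every pair sum of ±a is at most N.  On the upper rows, (B a)_i = 2 a_i, and since A₂
-- is constant on each pair, (A₂ a)_i only sees the pair sums, which improves the bound to
-- 2 |a_i| ≤ N.  Taking i where |a_i| = N gives 2N ≤ N, so N = 0 and a = 0.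
module Submission where

open import Defs
open import Level using (Level)
import Data.Nat as ℕ
open ℕ using (ℕ)
import Data.Nat.Properties as ℕₚ
open import Data.Nat.DivMod using (_/_; m*n/n≡m; +-distrib-/-∣ʳ)
open import Data.Nat.Divisibility using (n∣m*n)
open import Data.Fin using (Fin; zero; suc; toℕ; fromℕ<; cast; splitAt; _↑ˡ_; _↑ʳ_; _≟_)
import Data.Fin.Properties as Finₚ
open import Data.List using (allFin)
open import Data.List.Membership.Propositional using (lose)
open import Data.List.Membership.Propositional.Properties using (∈-allFin)
import Data.List.Extrema as Extrema
open import Data.Sum using (_⊎_; inj₁; inj₂)
open import Data.Product using (∃; _×_; _,_; proj₁; proj₂)
open import Function using (id; _∘_)
open import Relation.Nullary using (¬_; yes; no; contradiction)
open import Relation.Binary.Bundles using (TotalOrder)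
import Relation.Binary.Reasoning.PartialOrder as PosetReasoning
import Relation.Binary.Reasoning.Setoid as SetoidReasoning
open import Relation.Binary.PropositionalEquality as ≡ using (_≡_; _≢_)
import Algebra.Properties.Ring as RingProperties
import Algebra.Properties.CommutativeSemigroup as CommutativeSemigroupProperties

-- With 0-based indices, evenCol j and oddCol j are the columns 2j−1 and 2j of the paper.
evenCol : ∀ {k} → Fin k → Fin (2 ℕ.* k)
evenCol {k} j =
  fromℕ< (≡.subst (toℕ j ℕ.* 2 ℕ.<_) (ℕₚ.*-comm k 2) (ℕₚ.*-monoˡ-< 2 (Finₚ.toℕ<n j)))

oddCol : ∀ {k} → Fin k → Fin (2 ℕ.* k)
oddCol {k} j =
  fromℕ< (≡.subst (ℕ.suc (toℕ j ℕ.* 2) ℕ.<_) (ℕₚ.*-comm k 2) (ℕₚ.*-monoˡ-≤ 2 (Finₚ.toℕ<n j)))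

toℕ-evenCol : ∀ {k} (j : Fin k) → toℕ (evenCol j) ≡ toℕ j ℕ.* 2
toℕ-evenCol j = Finₚ.toℕ-fromℕ< _

toℕ-oddCol : ∀ {k} (j : Fin k) → toℕ (oddCol j) ≡ ℕ.suc (toℕ j ℕ.* 2)
toℕ-oddCol j = Finₚ.toℕ-fromℕ< _

evenCol/2 : ∀ {k} (j : Fin k) → toℕ (evenCol j) / 2 ≡ toℕ j
evenCol/2 j = ≡.trans (≡.cong (_/ 2) (toℕ-evenCol j)) (m*n/n≡m (toℕ j) 2)

oddCol/2 : ∀ {k} (j : Fin k) → toℕ (oddCol j) / 2 ≡ toℕ j
oddCol/2 j = ≡.trans (≡.cong (_/ 2) (toℕ-oddCol j))
               (≡.trans (+-distrib-/-∣ʳ 1 {d = 2} (n∣m*n (toℕ j))) (m*n/n≡m (toℕ j) 2))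

module _ {c ℓ₁ ℓ₂ : Level} (F : RealField c ℓ₁ ℓ₂) where
  open RealField F hiding (_≤_; zero)

  -- RealField declares no fixity for _≤_, so it would bind tighter than _+_.
  infix 4 _≤_
  _≤_ : Carrier → Carrier → Set ℓ₂
  _≤_ = RealField._≤_ F

  open RingProperties ring
    using ( -‿involutive; -0#≈0#; -1*x≈-x; -‿distribˡ-*; -‿distribʳ-*; -‿+-comm
          ; x[y-z]≈xy-xz; //-rightDividesʳ; //-rightDividesˡ; x∙y⁻¹≈ε⇒x≈y; \\-leftDividesˡ )
  open CommutativeSemigroupProperties +-commutativeSemigroup using (interchange)

  totalOrder : TotalOrder c ℓ₁ ℓ₂
  totalOrder = record { isTotalOrder = isTotalOrder }

  open TotalOrder totalOrder using (total; antisym; poset)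
    renaming (refl to ≤-refl; reflexive to ≤-reflexive; trans to ≤-trans)
  module ≤-Reasoning = PosetReasoning poset
  module ≈-Reasoning = SetoidReasoning setoid

  2# : Carrier
  2# = two F

  ½ : Carrier
  ½ = half F

  +-mono-≤₂ : ∀ {x y u v} → x ≤ y → u ≤ v → x + u ≤ y + v
  +-mono-≤₂ {x} {y} {u} {v} x≤y u≤v = begin
    x + u ≤⟨ +-mono-≤ u x≤y ⟩
    y + u ≈⟨ +-comm y u ⟩
    u + y ≤⟨ +-mono-≤ y u≤v ⟩
    v + y ≈⟨ +-comm v y ⟩
    y + v ∎
    where open ≤-Reasoning

  +-cancelʳ-≤ : ∀ {x y} z → x + z ≤ y + z → x ≤ y
  +-cancelʳ-≤ {x} {y} z p = begin
    x          ≈⟨ //-rightDividesʳ z x ⟨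
    x + z - z  ≤⟨ +-mono-≤ (- z) p ⟩
    y + z - z  ≈⟨ //-rightDividesʳ z y ⟩
    y          ∎
    where open ≤-Reasoning

  neg-mono-≤ : ∀ {x y} → x ≤ y → - y ≤ - x
  neg-mono-≤ {x} {y} x≤y = begin
    - y              ≈⟨ \\-leftDividesˡ x (- y) ⟨
    x + (- x + - y)  ≤⟨ +-mono-≤ (- x + - y) x≤y ⟩
    y + (- x + - y)  ≈⟨ +-congˡ (+-comm (- x) (- y)) ⟩
    y + (- y + - x)  ≈⟨ \\-leftDividesˡ y (- x) ⟩
    - x              ∎
    where open ≤-Reasoning

  x≤y⇒0≤y-x : ∀ {x y} → x ≤ y → 0# ≤ y - x
  x≤y⇒0≤y-x {x} {y} x≤y = ≤-trans (≤-reflexive (sym (-‿inverseʳ x))) (+-mono-≤ (- x) x≤y)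

  0≤y-x⇒x≤y : ∀ {x y} → 0# ≤ y - x → x ≤ y
  0≤y-x⇒x≤y {x} {y} 0≤y-x = begin
    x          ≈⟨ +-identityˡ x ⟨
    0# + x     ≤⟨ +-mono-≤ x 0≤y-x ⟩
    y - x + x  ≈⟨ //-rightDividesˡ x y ⟩
    y          ∎
    where open ≤-Reasoning

  *-monoˡ-≤-nonneg : ∀ {w x y} → 0# ≤ w → x ≤ y → w * x ≤ w * y
  *-monoˡ-≤-nonneg {w} {x} {y} 0≤w x≤y =
    0≤y-x⇒x≤y (≤-trans (*-nonneg 0≤w (x≤y⇒0≤y-x x≤y)) (≤-reflexive (x[y-z]≈xy-xz w y x)))

  *-monoʳ-≤-nonneg : ∀ {w x y} → 0# ≤ w → x ≤ y → x * w ≤ y * w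
  *-monoʳ-≤-nonneg {w} {x} {y} 0≤w x≤y = begin
    x * w  ≈⟨ *-comm x w ⟩
    w * x  ≤⟨ *-monoˡ-≤-nonneg 0≤w x≤y ⟩
    w * y  ≈⟨ *-comm w y ⟩
    y * w  ∎
    where open ≤-Reasoning

  0≤1 : 0# ≤ 1#
  0≤1 with total 0# 1#
  ... | inj₁ 0≤1 = 0≤1
  ... | inj₂ 1≤0 = begin
    0#               ≤⟨ *-nonneg 0≤-1 0≤-1 ⟩
    - 1# * - 1#      ≈⟨ -1*x≈-x (- 1#) ⟩
    - - 1#           ≈⟨ -‿involutive 1# ⟩
    1#               ∎
    where
    open ≤-Reasoning
    0≤-1 : 0# ≤ - 1#
    0≤-1 = ≤-trans (≤-reflexive (sym -0#≈0#)) (neg-mono-≤ 1≤0)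

  0≤2 : 0# ≤ 2#
  0≤2 = ≤-trans (≤-reflexive (sym (+-identityʳ 0#))) (+-mono-≤₂ 0≤1 0≤1)

  2≉0 : ¬ 2# ≈ 0#
  2≉0 2≈0 = 0≉1 (antisym 0≤1 1≤0)
    where
    1≤0 : 1# ≤ 0#
    1≤0 = begin
      1#       ≈⟨ +-identityʳ 1# ⟨
      1# + 0#  ≤⟨ +-mono-≤₂ ≤-refl 0≤1 ⟩
      2#       ≈⟨ 2≈0 ⟩
      0#       ∎
      where open ≤-Reasoning

  2*½≈1 : 2# * ½ ≈ 1#
  2*½≈1 = ⁻¹-inverse 2# 2≉0

  x*2*½≈x : ∀ x → x * 2# * ½ ≈ x
  x*2*½≈x x = trans (*-assoc x 2# ½) (trans (*-congˡ 2*½≈1) (*-identityʳ x))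

  x*½*2≈x : ∀ x → x * ½ * 2# ≈ x
  x*½*2≈x x = trans (*-assoc x ½ 2#) (trans (*-congˡ (trans (*-comm ½ 2#) 2*½≈1)) (*-identityʳ x))

  x*2≈x+x : ∀ x → x * 2# ≈ x + x
  x*2≈x+x x = trans (distribˡ x 1# 1#) (+-cong (*-identityʳ x) (*-identityʳ x))

  0≤½ : 0# ≤ ½
  0≤½ with total 0# ½
  ... | inj₁ 0≤½ = 0≤½
  ... | inj₂ ½≤0 = contradiction (antisym 0≤1 1≤0) 0≉1
    where
    1≤0 : 1# ≤ 0#
    1≤0 = begin
      1#      ≈⟨ 2*½≈1 ⟨
      2# * ½  ≤⟨ *-monoˡ-≤-nonneg 0≤2 ½≤0 ⟩
      2# * 0# ≈⟨ zeroʳ 2# ⟩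
      0#      ∎
      where open ≤-Reasoning

  *2-cancel-≤ : ∀ {x y} → x * 2# ≤ y * 2# → x ≤ y
  *2-cancel-≤ {x} {y} p = begin
    x           ≈⟨ x*2*½≈x x ⟨
    x * 2# * ½  ≤⟨ *-monoʳ-≤-nonneg 0≤½ p ⟩
    y * 2# * ½  ≈⟨ x*2*½≈x y ⟩
    y           ∎
    where open ≤-Reasoning

  x*2≤x⇒x≤0 : ∀ {x} → x * 2# ≤ x → x ≤ 0#
  x*2≤x⇒x≤0 {x} p = +-cancelʳ-≤ x (begin
    x + x   ≈⟨ x*2≈x+x x ⟨
    x * 2#  ≤⟨ p ⟩
    x       ≈⟨ +-identityˡ x ⟨
    0# + x  ∎)
    where open ≤-Reasoning

  scaled-sum-≤ : ∀ {N x y} → 0# ≤ N → x + y ≤ 1# → N * x + N * y ≤ N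
  scaled-sum-≤ {N} {x} {y} 0≤N x+y≤1 = begin
    N * x + N * y  ≈⟨ distribˡ N x y ⟨
    N * (x + y)    ≤⟨ *-monoˡ-≤-nonneg 0≤N x+y≤1 ⟩
    N * 1#         ≈⟨ *-identityʳ N ⟩
    N              ∎
    where open ≤-Reasoning

  infix 4 ∣_∣≤_
  ∣_∣≤_ : Carrier → Carrier → Set ℓ₂
  ∣ x ∣≤ N = x ≤ N × - x ≤ N

  ∣∣≤-neg : ∀ {x N} → ∣ x ∣≤ N → ∣ - x ∣≤ N
  ∣∣≤-neg {x} (x≤N , -x≤N) = -x≤N , ≤-trans (≤-reflexive (-‿involutive x)) x≤N

  ∣∣≤⇒0≤ : ∀ {x N} → ∣ x ∣≤ N → 0# ≤ N
  ∣∣≤⇒0≤ {x} {N} (x≤N , -x≤N) = *2-cancel-≤ (begin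
    0# * 2#  ≈⟨ zeroˡ 2# ⟩
    0#       ≈⟨ -‿inverseʳ x ⟨
    x - x    ≤⟨ +-mono-≤₂ x≤N -x≤N ⟩
    N + N    ≈⟨ x*2≈x+x N ⟨
    N * 2#   ∎)
    where open ≤-Reasoning

  ∣∣≤-nonpos⇒≈0 : ∀ {x N} → ∣ x ∣≤ N → N ≤ 0# → x ≈ 0#
  ∣∣≤-nonpos⇒≈0 {x} (x≤N , -x≤N) N≤0 = antisym (≤-trans x≤N N≤0) (begin
    0#     ≈⟨ -0#≈0# ⟨
    - 0#   ≤⟨ neg-mono-≤ (≤-trans -x≤N N≤0) ⟩
    - - x  ≈⟨ -‿involutive x ⟩
    x      ∎)
    where open ≤-Reasoning

  argmax-dominates : ∀ {m} (g : Fin m → Carrier) (j : Fin m) →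
                     ∀ i → g i ≤ g (Extrema.argmax totalOrder g j (allFin m))
  argmax-dominates {m} g j i =
    Extrema.v≤f[argmax]⁺ totalOrder {f = g} j (allFin m) (inj₂ (lose (∈-allFin i) ≤-refl))

  abs-argmax : ∀ {m} (a : Fin m → Carrier) → Fin m →
               ∃ λ r → (∀ c → ∣ a c ∣≤ a r) ⊎ (∀ c → ∣ a c ∣≤ - a r)
  abs-argmax {m} a j =
    larger (Extrema.argmax totalOrder a j (allFin m)) (argmax-dominates a j)
           (Extrema.argmax totalOrder (-_ ∘ a) j (allFin m)) (argmax-dominates (-_ ∘ a) j)
    where
    larger : ∀ p → (∀ c → a c ≤ a p) → ∀ q → (∀ c → - a c ≤ - a q) →
             ∃ λ r → (∀ c → ∣ a c ∣≤ a r) ⊎ (∀ c → ∣ a c ∣≤ - a r)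
    larger p a≤ap q -a≤-aq with total (a p) (- a q)
    ... | inj₁ ap≤-aq = q , inj₂ λ c → ≤-trans (a≤ap c) ap≤-aq , -a≤-aq c
    ... | inj₂ -aq≤ap = p , inj₁ λ c → a≤ap c , ≤-trans (-a≤-aq c) -aq≤ap

  ∑ : (n : ℕ) → (Fin n → Carrier) → Carrier
  ∑ = sumF F

  ∑-cong : ∀ n {f g : Fin n → Carrier} → (∀ i → f i ≈ g i) → ∑ n f ≈ ∑ n g
  ∑-cong ℕ.zero    f≈g = refl
  ∑-cong (ℕ.suc n) f≈g = +-cong (f≈g zero) (∑-cong n (f≈g ∘ suc))

  ∑-distrib-+ : ∀ n (f g : Fin n → Carrier) → ∑ n (λ i → f i + g i) ≈ ∑ n f + ∑ n g
  ∑-distrib-+ ℕ.zero    f g = sym (+-identityʳ 0#)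
  ∑-distrib-+ (ℕ.suc n) f g =
    trans (+-congˡ (∑-distrib-+ n (f ∘ suc) (g ∘ suc))) (interchange (f zero) (g zero) _ _)

  ∑-neg : ∀ n (f : Fin n → Carrier) → ∑ n (λ i → - f i) ≈ - ∑ n f
  ∑-neg ℕ.zero    f = sym -0#≈0#
  ∑-neg (ℕ.suc n) f = trans (+-congˡ (∑-neg n (f ∘ suc))) (-‿+-comm (f zero) _)

  *-distribˡ-∑ : ∀ n w (f : Fin n → Carrier) → ∑ n (λ i → w * f i) ≈ w * ∑ n f
  *-distribˡ-∑ ℕ.zero    w f = sym (zeroʳ w)
  *-distribˡ-∑ (ℕ.suc n) w f = trans (+-congˡ (*-distribˡ-∑ n w (f ∘ suc))) (sym (distribˡ w _ _))

  ∑-zero : ∀ n → ∑ n (λ _ → 0#) ≈ 0#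
  ∑-zero ℕ.zero    = refl
  ∑-zero (ℕ.suc n) = trans (+-congˡ (∑-zero n)) (+-identityʳ 0#)

  ∑-mono-≤ : ∀ n {f g : Fin n → Carrier} → (∀ i → f i ≤ g i) → ∑ n f ≤ ∑ n g
  ∑-mono-≤ ℕ.zero    f≤g = ≤-refl
  ∑-mono-≤ (ℕ.suc n) f≤g = +-mono-≤₂ (f≤g zero) (∑-mono-≤ n (f≤g ∘ suc))

  ∑-nonneg : ∀ n {f : Fin n → Carrier} → (∀ i → 0# ≤ f i) → 0# ≤ ∑ n f
  ∑-nonneg n 0≤f = ≤-trans (≤-reflexive (sym (∑-zero n))) (∑-mono-≤ n 0≤f)

  ∑-single : ∀ n (g : Fin n → Carrier) r → (∀ i → r ≢ i → g i ≈ 0#) → ∑ n g ≈ g r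
  ∑-single (ℕ.suc n) g zero    g≈0 =
    trans (+-congˡ (trans (∑-cong n (λ i → g≈0 (suc i) λ ())) (∑-zero n))) (+-identityʳ _)
  ∑-single (ℕ.suc n) g (suc r) g≈0 =
    trans (+-cong (g≈0 zero λ ())
                  (∑-single n (g ∘ suc) r λ i r≢i → g≈0 (suc i) (r≢i ∘ Finₚ.suc-injective)))
          (+-identityˡ _)

  ∑-cast : ∀ {m n} (m≡n : m ≡ n) (f : Fin n → Carrier) → ∑ n f ≈ ∑ m (f ∘ cast m≡n)
  ∑-cast {m} ≡.refl f = ∑-cong m (λ i → reflexive (≡.cong f (≡.sym (Finₚ.cast-is-id ≡.refl i))))

  ∑-weighted-≤ : ∀ n {N} (y w : Fin n → Carrier) → (∀ i → 0# ≤ w i) → (∀ i → y i ≤ N) →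
                 ∑ n (λ i → y i * w i) ≤ N * ∑ n w
  ∑-weighted-≤ n {N} y w 0≤w y≤N = begin
    ∑ n (λ i → y i * w i)  ≤⟨ ∑-mono-≤ n (λ i → *-monoʳ-≤-nonneg (0≤w i) (y≤N i)) ⟩
    ∑ n (λ i → N * w i)    ≈⟨ *-distribˡ-∑ n N w ⟩
    N * ∑ n w              ∎
    where open ≤-Reasoning

  ∑-pairs : ∀ k (f : Fin (2 ℕ.* k) → Carrier) →
            ∑ (2 ℕ.* k) f ≈ ∑ k (λ j → f (evenCol j) + f (oddCol j))
  ∑-pairs ℕ.zero    f = refl
  -- 2 * suc k is not definitionally 2 + 2 * k, so the first two terms are exposed by a cast.
  ∑-pairs (ℕ.suc k) f = begin
    ∑ (2 ℕ.* ℕ.suc k) f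
      ≈⟨ ∑-cast 2+2k≡2[1+k] f ⟩
    g zero + (g (suc zero) + ∑ (2 ℕ.* k) (g ∘ suc ∘ suc))
      ≈⟨ +-assoc _ _ _ ⟨
    g zero + g (suc zero) + ∑ (2 ℕ.* k) (g ∘ suc ∘ suc)
      ≈⟨ +-congˡ (∑-pairs k (g ∘ suc ∘ suc)) ⟩
    g zero + g (suc zero) + ∑ k (λ j → g (suc (suc (evenCol j))) + g (suc (suc (oddCol j))))
      ≈⟨ +-cong (+-cong (g≈f (≡.sym (toℕ-evenCol {ℕ.suc k} zero)))
                        (g≈f (≡.sym (toℕ-oddCol {ℕ.suc k} zero))))
                (∑-cong k λ j → +-cong (g≈f (evenStep j)) (g≈f (oddStep j))) ⟩
    ∑ (ℕ.suc k) (λ j → f (evenCol j) + f (oddCol j))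
      ∎
    where
    open ≈-Reasoning
    2+2k≡2[1+k] : 2 ℕ.+ 2 ℕ.* k ≡ 2 ℕ.* ℕ.suc k
    2+2k≡2[1+k] = ≡.sym (ℕₚ.*-suc 2 k)
    g : Fin (2 ℕ.+ 2 ℕ.* k) → Carrier
    g = f ∘ cast 2+2k≡2[1+k]
    g≈f : ∀ {i j} → toℕ i ≡ toℕ j → g i ≈ f j
    g≈f {i} i≡j =
      reflexive (≡.cong f (Finₚ.toℕ-injective (≡.trans (Finₚ.toℕ-cast 2+2k≡2[1+k] i) i≡j)))
    evenStep : ∀ j → toℕ (suc (suc (evenCol j))) ≡ toℕ (evenCol {ℕ.suc k} (suc j))
    evenStep j = ≡.trans (≡.cong (ℕ.suc ∘ ℕ.suc) (toℕ-evenCol j)) (≡.sym (toℕ-evenCol (suc j)))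
    oddStep : ∀ j → toℕ (suc (suc (oddCol j))) ≡ toℕ (oddCol {ℕ.suc k} (suc j))
    oddStep j = ≡.trans (≡.cong (ℕ.suc ∘ ℕ.suc) (toℕ-oddCol j)) (≡.sym (toℕ-oddCol (suc j)))

  infixl 7 _*ᵥ_
  _*ᵥ_ : ∀ {m n} → Matrix F m n → (Fin n → Carrier) → Fin m → Carrier
  (M *ᵥ a) i = ∑ _ (λ j → a j * M i j)

  *ᵥ-⊞ : ∀ {m n} (M N : Matrix F m n) a i → (_⊞_ F M N *ᵥ a) i ≈ (M *ᵥ a) i + (N *ᵥ a) i
  *ᵥ-⊞ {n = n} M N a i = trans (∑-cong n λ j → distribˡ (a j) (M i j) (N i j)) (∑-distrib-+ n _ _)

  *ᵥ-⊟ : ∀ {m n} (M N : Matrix F m n) a i → (_⊟_ F M N *ᵥ a) i ≈ (M *ᵥ a) i - (N *ᵥ a) i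
  *ᵥ-⊟ {n = n} M N a i = begin
    ∑ n (λ j → a j * (M i j - N i j))        ≈⟨ ∑-cong n (λ j → x[y-z]≈xy-xz (a j) _ _) ⟩
    ∑ n (λ j → a j * M i j - a j * N i j)    ≈⟨ ∑-distrib-+ n _ _ ⟩
    (M *ᵥ a) i + ∑ n (λ j → - (a j * N i j)) ≈⟨ +-congˡ (∑-neg n _) ⟩
    (M *ᵥ a) i - (N *ᵥ a) i                  ∎
    where open ≈-Reasoning

  *ᵥ-neg : ∀ {m n} (M : Matrix F m n) a i → (M *ᵥ (-_ ∘ a)) i ≈ - (M *ᵥ a) i
  *ᵥ-neg {n = n} M a i = trans (∑-cong n λ j → sym (-‿distribˡ-* (a j) (M i j))) (∑-neg n _)

  trivialKernel⇒HasRank : ∀ {m n} (M : Matrix F m n) →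
                          (∀ a → (∀ i → (M *ᵥ a) i ≈ 0#) → ∀ j → a j ≈ 0#) → HasRank F M n
  trivialKernel⇒HasRank {n = n} M kernel-trivial =
    (id , id , kernel-trivial) , λ _ σ-injective _ → Finₚ.<⇒notInjective (ℕₚ.n<1+n n) σ-injective

  Bmat-upper-diag : ∀ k (r : Fin (2 ℕ.* k)) → Bmat F k (r ↑ˡ k) r ≈ 2#
  Bmat-upper-diag k r with splitAt (2 ℕ.* k) (r ↑ˡ k) | Finₚ.splitAt-↑ˡ (2 ℕ.* k) r k
  ... | _ | ≡.refl with r ≟ r
  ...   | yes _   = refl
  ...   | no r≢r  = contradiction ≡.refl r≢r

  Bmat-upper-off : ∀ k (r c : Fin (2 ℕ.* k)) → r ≢ c → Bmat F k (r ↑ˡ k) c ≈ 0#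
  Bmat-upper-off k r c r≢c with splitAt (2 ℕ.* k) (r ↑ˡ k) | Finₚ.splitAt-↑ˡ (2 ℕ.* k) r k
  ... | _ | ≡.refl with r ≟ c
  ...   | yes r≡c = contradiction r≡c r≢c
  ...   | no _    = refl

  Bmat-lower-pair : ∀ k (j : Fin k) c → toℕ c / 2 ≡ toℕ j → Bmat F k ((2 ℕ.* k) ↑ʳ j) c ≈ - 2#
  Bmat-lower-pair k j c c∈j with splitAt (2 ℕ.* k) ((2 ℕ.* k) ↑ʳ j) | Finₚ.splitAt-↑ʳ (2 ℕ.* k) k j
  ... | _ | ≡.refl with toℕ c / 2 ℕ.≟ toℕ j
  ...   | yes _   = refl
  ...   | no c∉j  = contradiction c∈j c∉j

  Bmat-lower-off : ∀ k (j : Fin k) c → toℕ c / 2 ≢ toℕ j → Bmat F k ((2 ℕ.* k) ↑ʳ j) c ≈ 0#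
  Bmat-lower-off k j c c∉j with splitAt (2 ℕ.* k) ((2 ℕ.* k) ↑ʳ j) | Finₚ.splitAt-↑ʳ (2 ℕ.* k) k j
  ... | _ | ≡.refl with toℕ c / 2 ℕ.≟ toℕ j
  ...   | yes c∈j = contradiction c∈j c∉j
  ...   | no _    = refl

  Bmat-upper-*ᵥ : ∀ k a (r : Fin (2 ℕ.* k)) → (Bmat F k *ᵥ a) (r ↑ˡ k) ≈ a r * 2#
  Bmat-upper-*ᵥ k a r = trans
    (∑-single (2 ℕ.* k) _ r λ c r≢c → trans (*-congˡ (Bmat-upper-off k r c r≢c)) (zeroʳ (a c)))
    (*-congˡ (Bmat-upper-diag k r))

  Bmat-lower-*ᵥ : ∀ k a (j : Fin k) →
                  (Bmat F k *ᵥ a) ((2 ℕ.* k) ↑ʳ j) ≈ - (a (evenCol j) + a (oddCol j)) * 2#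
  Bmat-lower-*ᵥ k a j = begin
    (Bmat F k *ᵥ a) i
      ≈⟨ ∑-pairs k _ ⟩
    ∑ k term
      ≈⟨ ∑-single k term j term-off ⟩
    term j
      ≈⟨ +-cong (in-pair _ (evenCol/2 j)) (in-pair _ (oddCol/2 j)) ⟩
    a (evenCol j) * - 2# + a (oddCol j) * - 2#
      ≈⟨ distribʳ (- 2#) _ _ ⟨
    (a (evenCol j) + a (oddCol j)) * - 2#
      ≈⟨ -‿distribʳ-* _ 2# ⟨
    - ((a (evenCol j) + a (oddCol j)) * 2#)
      ≈⟨ -‿distribˡ-* _ 2# ⟩
    - (a (evenCol j) + a (oddCol j)) * 2#
      ∎
    where
    open ≈-Reasoning
    i = (2 ℕ.* k) ↑ʳ j
    term : Fin k → Carrier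
    term j′ = a (evenCol j′) * Bmat F k i (evenCol j′) + a (oddCol j′) * Bmat F k i (oddCol j′)
    in-pair : ∀ c → toℕ c / 2 ≡ toℕ j → a c * Bmat F k i c ≈ a c * - 2#
    in-pair c c∈j = *-congˡ (Bmat-lower-pair k j c c∈j)
    out-of-pair : (col : Fin k → Fin (2 ℕ.* k)) → (∀ j′ → toℕ (col j′) / 2 ≡ toℕ j′) →
                  ∀ {j′} → j ≢ j′ → a (col j′) * Bmat F k i (col j′) ≈ 0#
    out-of-pair col col/2 {j′} j≢j′ = trans (*-congˡ (Bmat-lower-off k j _ c∉j)) (zeroʳ _)
      where
      c∉j : toℕ (col j′) / 2 ≢ toℕ j
      c∉j c∈j = j≢j′ (Finₚ.toℕ-injective (≡.trans (≡.sym c∈j) (col/2 j′)))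
    term-off : ∀ j′ → j ≢ j′ → term j′ ≈ 0#
    term-off j′ j≢j′ =
      trans (+-cong (out-of-pair evenCol evenCol/2 j≢j′) (out-of-pair oddCol oddCol/2 j≢j′))
            (+-identityʳ 0#)

  module PerturbedKernel
    (k : ℕ) (A₁ A₂ : Matrix F (2 ℕ.* k ℕ.+ k) (2 ℕ.* k))
    (A₁≥0 : ∀ i j → 0# ≤ A₁ i j) (A₂≥0 : ∀ i j → 0# ≤ A₂ i j)
    (A₂-pairwise : ∀ i (c c′ : Fin (2 ℕ.* k)) → toℕ c / 2 ≡ toℕ c′ / 2 → A₂ i c ≈ A₂ i c′)
    (row-budget : ∀ i → ∑ (2 ℕ.* k) (λ j → A₁ i j + A₂ i j * ½) ≤ 1#)
    where

    B M : Matrix F (2 ℕ.* k ℕ.+ k) (2 ℕ.* k)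
    B = Bmat F k
    M = _⊟_ F (_⊞_ F B A₁) A₂

    InKernel : (Fin (2 ℕ.* k) → Carrier) → Set ℓ₁
    InKernel a = ∀ i → (M *ᵥ a) i ≈ 0#

    kernel-neg : ∀ {a} → InKernel a → InKernel (-_ ∘ a)
    kernel-neg {a} Ma≈0 i = trans (*ᵥ-neg M a i) (trans (-‿cong (Ma≈0 i)) -0#≈0#)

    M*ᵥ : ∀ a i → (M *ᵥ a) i ≈ (B *ᵥ a) i + (A₁ *ᵥ a) i - (A₂ *ᵥ a) i
    M*ᵥ a i = trans (*ᵥ-⊟ (_⊞_ F B A₁) A₂ a i) (+-congʳ (*ᵥ-⊞ B A₁ a i))

    kernel-row : ∀ {a} → InKernel a → ∀ i → (B *ᵥ a) i ≈ (A₂ *ᵥ a) i - (A₁ *ᵥ a) i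
    kernel-row {a} Ma≈0 i = begin
      (B *ᵥ a) i                              ≈⟨ //-rightDividesʳ ((A₁ *ᵥ a) i) _ ⟨
      (B *ᵥ a) i + (A₁ *ᵥ a) i - (A₁ *ᵥ a) i
        ≈⟨ +-congʳ (x∙y⁻¹≈ε⇒x≈y _ _ (trans (sym (M*ᵥ a i)) (Ma≈0 i))) ⟩
      (A₂ *ᵥ a) i - (A₁ *ᵥ a) i               ∎
      where open ≈-Reasoning

    load₁ load₂ : Fin (2 ℕ.* k ℕ.+ k) → Carrier
    load₁ i = ∑ (2 ℕ.* k) (A₁ i)
    load₂ i = ∑ (2 ℕ.* k) (λ c → A₂ i c * ½)

    load-budget : ∀ i → load₂ i + load₁ i ≤ 1#
    load-budget i =
      ≤-trans (≤-reflexive (trans (+-comm _ _) (sym (∑-distrib-+ (2 ℕ.* k) _ _)))) (row-budget i)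

    A₂-row-sum : ∀ i → ∑ (2 ℕ.* k) (A₂ i) ≈ 2# * load₂ i
    A₂-row-sum i = trans (∑-cong (2 ℕ.* k) λ c → sym (trans (*-comm 2# _) (x*½*2≈x (A₂ i c))))
                         (*-distribˡ-∑ (2 ℕ.* k) 2# _)

    A₂-odd≈even : ∀ i (j : Fin k) → A₂ i (oddCol j) ≈ A₂ i (evenCol j)
    A₂-odd≈even i j =
      A₂-pairwise i (oddCol j) (evenCol j) (≡.trans (oddCol/2 j) (≡.sym (evenCol/2 j)))

    A₂-pair-sum : ∀ i → ∑ k (λ j → A₂ i (evenCol j)) ≈ load₂ i
    A₂-pair-sum i = sym (trans (∑-pairs k _) (∑-cong k λ j → begin
      A₂ i (evenCol j) * ½ + A₂ i (oddCol j) * ½  ≈⟨ +-congˡ (*-congʳ (A₂-odd≈even i j)) ⟩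
      A₂ i (evenCol j) * ½ + A₂ i (evenCol j) * ½ ≈⟨ x*2≈x+x _ ⟨
      A₂ i (evenCol j) * ½ * 2#                   ≈⟨ x*½*2≈x _ ⟩
      A₂ i (evenCol j)                            ∎))
      where open ≈-Reasoning

    A₁-bound : ∀ {a N} → (∀ c → ∣ a c ∣≤ N) → ∀ i → - (A₁ *ᵥ a) i ≤ N * load₁ i
    A₁-bound {a} {N} dom i = begin
      - (A₁ *ᵥ a) i       ≈⟨ *ᵥ-neg A₁ a i ⟨
      (A₁ *ᵥ (-_ ∘ a)) i  ≤⟨ ∑-weighted-≤ (2 ℕ.* k) (-_ ∘ a) (A₁ i) (A₁≥0 i) (proj₂ ∘ dom) ⟩
      N * load₁ i         ∎
      where open ≤-Reasoning

    A₂-bound : ∀ {a N} → (∀ c → ∣ a c ∣≤ N) → ∀ i → (A₂ *ᵥ a) i ≤ N * 2# * load₂ i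
    A₂-bound {a} {N} dom i = begin
      (A₂ *ᵥ a) i                ≤⟨ ∑-weighted-≤ (2 ℕ.* k) a (A₂ i) (A₂≥0 i) (proj₁ ∘ dom) ⟩
      N * ∑ (2 ℕ.* k) (A₂ i)     ≈⟨ *-congˡ (A₂-row-sum i) ⟩
      N * (2# * load₂ i)         ≈⟨ *-assoc N 2# _ ⟨
      N * 2# * load₂ i           ∎
      where open ≤-Reasoning

    A₂-bound-paired : ∀ {a N} → (∀ j → a (evenCol j) + a (oddCol j) ≤ N) →
                      ∀ i → (A₂ *ᵥ a) i ≤ N * load₂ i
    A₂-bound-paired {a} {N} pair≤N i = begin
      (A₂ *ᵥ a) i
        ≈⟨ ∑-pairs k _ ⟩
      ∑ k (λ j → a (evenCol j) * A₂ i (evenCol j) + a (oddCol j) * A₂ i (oddCol j))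
        ≈⟨ ∑-cong k (λ j → trans (+-congˡ (*-congˡ (A₂-odd≈even i j))) (sym (distribʳ _ _ _))) ⟩
      ∑ k (λ j → (a (evenCol j) + a (oddCol j)) * A₂ i (evenCol j))
        ≤⟨ ∑-weighted-≤ k _ _ (λ j → A₂≥0 i (evenCol j)) pair≤N ⟩
      N * ∑ k (λ j → A₂ i (evenCol j))
        ≈⟨ *-congˡ (A₂-pair-sum i) ⟩
      N * load₂ i
        ∎
      where open ≤-Reasoning

    pair-sum-lower : ∀ {a N} → InKernel a → (∀ c → ∣ a c ∣≤ N) →
                     ∀ j → - (a (evenCol j) + a (oddCol j)) ≤ N
    pair-sum-lower {a} {N} Ma≈0 dom j = *2-cancel-≤ (begin
      - (a (evenCol j) + a (oddCol j)) * 2#  ≈⟨ Bmat-lower-*ᵥ k a j ⟨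
      (B *ᵥ a) i                             ≈⟨ kernel-row Ma≈0 i ⟩
      (A₂ *ᵥ a) i - (A₁ *ᵥ a) i              ≤⟨ +-mono-≤₂ (A₂-bound dom i) (A₁-bound dom i) ⟩
      N * 2# * load₂ i + N * load₁ i         ≤⟨ +-mono-≤₂ ≤-refl (*-monoʳ-≤-nonneg load₁≥0 N≤N*2) ⟩
      N * 2# * load₂ i + N * 2# * load₁ i    ≤⟨ scaled-sum-≤ (*-nonneg 0≤N 0≤2) (load-budget i) ⟩
      N * 2#                                 ∎)
      where
      open ≤-Reasoning
      i = (2 ℕ.* k) ↑ʳ j
      0≤N : 0# ≤ N
      0≤N = ∣∣≤⇒0≤ (dom (evenCol j))
      load₁≥0 : 0# ≤ load₁ i
      load₁≥0 = ∑-nonneg (2 ℕ.* k) (A₁≥0 i)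
      N≤N*2 : N ≤ N * 2#
      N≤N*2 = begin
        N       ≈⟨ +-identityʳ N ⟨
        N + 0#  ≤⟨ +-mono-≤₂ ≤-refl 0≤N ⟩
        N + N   ≈⟨ x*2≈x+x N ⟨
        N * 2#  ∎

    entry-upper : ∀ {a N} → InKernel a → (∀ c → ∣ a c ∣≤ N) → ∀ r → a r * 2# ≤ N
    entry-upper {a} {N} Ma≈0 dom r = begin
      a r * 2#                   ≈⟨ Bmat-upper-*ᵥ k a r ⟨
      (B *ᵥ a) i                 ≈⟨ kernel-row Ma≈0 i ⟩
      (A₂ *ᵥ a) i - (A₁ *ᵥ a) i  ≤⟨ +-mono-≤₂ (A₂-bound-paired pair-sum≤N i) (A₁-bound dom i) ⟩
      N * load₂ i + N * load₁ i  ≤⟨ scaled-sum-≤ (∣∣≤⇒0≤ (dom r)) (load-budget i) ⟩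
      N                          ∎
      where
      open ≤-Reasoning
      i = r ↑ˡ k
      pair-sum≤N : ∀ j → a (evenCol j) + a (oddCol j) ≤ N
      pair-sum≤N j = ≤-trans (≤-reflexive (sym (trans (-‿cong (-‿+-comm _ _)) (-‿involutive _))))
                             (pair-sum-lower (kernel-neg Ma≈0) (∣∣≤-neg ∘ dom) j)

    kernel-trivial : ∀ a → InKernel a → ∀ j → a j ≈ 0#
    kernel-trivial a Ma≈0 j with abs-argmax a j
    ... | r , inj₁ dom = ∣∣≤-nonpos⇒≈0 (dom j) (x*2≤x⇒x≤0 (entry-upper Ma≈0 dom r))
    ... | r , inj₂ dom =
      ∣∣≤-nonpos⇒≈0 (dom j) (x*2≤x⇒x≤0 (entry-upper (kernel-neg Ma≈0) (∣∣≤-neg ∘ dom) r))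

-- Imported only here, since above _+_ and _*_ are the field operations.
open import Data.Nat using (_+_; _*_)

lemma7p3 : ∀ {c ℓ₁ ℓ₂ : Level} (F : RealField c ℓ₁ ℓ₂) (k : ℕ)
             (A₁ A₂ : Matrix F (2 * k + k) (2 * k)) →
             (∀ i j → RealField._≤_ F (RealField.0# F) (A₁ i j)) →
             (∀ i j → RealField._≤_ F (RealField.0# F) (A₂ i j)) →
             (∀ i (c c′ : Fin (2 * k)) → toℕ c / 2 ≡ toℕ c′ / 2 →
                RealField._≈_ F (A₂ i c) (A₂ i c′)) →
             (∀ i → RealField._≤_ F
                      (sumF F (2 * k) (λ j → RealField._+_ F (A₁ i j)
                                               (RealField._*_ F (A₂ i j) (half F))))
                      (RealField.1# F)) →
             HasRank F (_⊟_ F (_⊞_ F (Bmat F k) A₁) A₂) (2 * k)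
lemma7p3 F k A₁ A₂ A₁≥0 A₂≥0 A₂-pairwise row-budget =
  trivialKernel⇒HasRank F _
    (PerturbedKernel.kernel-trivial F k A₁ A₂ A₁≥0 A₂≥0 A₂-pairwise row-budget)
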